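{- Let $G$ be a simple graph and $c$ a positive integer. Then $G$ has chromatic number $c$ if and only if for every $s\in\mathbb{N}$ the $s$-jet graph $\mathcal{J}_s(G)$ has chromatic number $c$.
   Context: For a simple graph $G$ with vertex set $\{x_1,\dots,x_n\}$ and $s\in\mathbb{N}$, the $s$-jet graph $\mathcal{J}_s(G)$ is the simple graph with vertex set $\{x_{i,j}\mid i=1,\dots,n,\ j=0,\dots,s\}$ in which $\{x_{i,j},x_{k,l}\}$ is an edge if and only if $\{x_i,x_k\}$ is an edge of $G$ and $j+l\leqslant s$. (Equivalently, it is the graph whose edge ideal is the radical of the ideal of $s$-jets of the edge ideal of $G$.) Note $\mathcal{J}_0(G)\cong G$. -}

module Defs where

open import Data.Nat using (ℕ; suc; _+_; _≤_; _<_)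
open import Data.Fin using (Fin; toℕ)
open import Data.Bool using (Bool; true; false)
open import Data.Product using (_×_; _,_; Σ)
open import Relation.Binary.PropositionalEquality using (_≡_; _≢_)
open import Relation.Nullary using (¬_)

record SimpleGraph (V : Set) : Set where
  field
    adj   : V → V → Bool
    sym   : ∀ u v → adj u v ≡ adj v u
    irrefl : ∀ v → adj v v ≡ false
open SimpleGraph public

Adj : {V : Set} → SimpleGraph V → V → V → Set
Adj G u v = adj G u v ≡ true

ProperColouring : {V : Set} → SimpleGraph V → ℕ → Set
ProperColouring {V} G k = Σ (V → Fin k) λ f → ∀ u v → Adj G u v → f u ≢ f v

Colourable : {V : Set} → SimpleGraph V → ℕ → Set
Colourable G k = ProperColouring G k

HasChromaticNumber : {V : Set} → SimpleGraph V → ℕ → Set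
HasChromaticNumber G c = Colourable G c × (∀ k → k < c → ¬ Colourable G k)

private
  leqb : ℕ → ℕ → Bool
  leqb 0 _ = true
  leqb (suc m) 0 = false
  leqb (suc m) (suc n) = leqb m n

  _∧_ : Bool → Bool → Bool
  true ∧ b = b
  false ∧ _ = false

  +-comm' : ∀ m n → m + n ≡ n + m
  +-comm' = Data.Nat.Properties.+-comm
    where import Data.Nat.Properties

open import Relation.Binary.PropositionalEquality using (refl; cong₂; cong)

jetAdj : {V : Set} → SimpleGraph V → (s : ℕ) → V × Fin (suc s) → V × Fin (suc s) → Bool
jetAdj G s (i , j) (k , l) = adj G i k ∧ leqb (toℕ j + toℕ l) s

private
  ∧-false : ∀ b → false ∧ b ≡ false
  ∧-false b = refl

JetGraph : {V : Set} → SimpleGraph V → (s : ℕ) → SimpleGraph (V × Fin (suc s))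
JetGraph G s = record
  { adj = jetAdj G s
  ; sym = λ { (i , j) (k , l) → cong₂ _∧_ (SimpleGraph.sym G i k) (cong (λ m → leqb m s) (+-comm' (toℕ j) (toℕ l))) }
  ; irrefl = λ { (i , j) → irr i j }
  }
  where
    irr : ∀ i j → jetAdj G s (i , j) (i , j) ≡ false
    irr i j with adj G i i | SimpleGraph.irrefl G i
    ... | false | _ = refl

{-# OPTIONS --safe #-}
module Submission where

-- The projection x_{i,j} ↦ x_i and the inclusion x_i ↦ x_{i,0} are graph
-- homomorphisms J_s(G) → G and G → J_s(G). Colourings pull back along
-- homomorphisms, so G and J_s(G) are colourable with exactly the same
-- numbers of colours, hence have the same chromatic number.

open import Defs
open import Data.Nat using (ℕ; NonZero)
open import Data.Fin using (Fin; zero)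
open import Data.Bool using (true; false)
open import Data.Product using (_,_; proj₁)
open import Function using (_∘_)
open import Function.Bundles using (_⇔_; mk⇔)
open import Relation.Binary.PropositionalEquality using (refl)

record Homomorphism {V W : Set} (G : SimpleGraph V) (H : SimpleGraph W) : Set where
  field
    map      : V → W
    preserve : ∀ u v → Adj G u v → Adj H (map u) (map v)
open Homomorphism

colourable-comap : {V W : Set} {G : SimpleGraph V} {H : SimpleGraph W} →
  Homomorphism G H → ∀ {k} → Colourable H k → Colourable G k
colourable-comap f (col , proper) =
  col ∘ map f , λ u v uv → proper (map f u) (map f v) (preserve f u v uv)

hasChromaticNumber-transport : {V W : Set} {G : SimpleGraph V} {H : SimpleGraph W} →
  Homomorphism G H → Homomorphism H G →
  ∀ {c} → HasChromaticNumber G c → HasChromaticNumber H c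
hasChromaticNumber-transport G→H H→G (colG , minimalG) =
  colourable-comap H→G colG , λ k k<c colH → minimalG k k<c (colourable-comap G→H colH)

jet-projection : {V : Set} (G : SimpleGraph V) (s : ℕ) → Homomorphism (JetGraph G s) G
jet-projection G s = record { map = proj₁ ; preserve = preserve′ }
  where
    preserve′ : ∀ x y → Adj (JetGraph G s) x y → Adj G (proj₁ x) (proj₁ y)
    preserve′ (i , _) (k , _) jet-ik with adj G i k
    ... | true  = refl
    ... | false = jet-ik

jet-base-inclusion : {V : Set} (G : SimpleGraph V) (s : ℕ) → Homomorphism G (JetGraph G s)
jet-base-inclusion G s = record { map = _, zero ; preserve = preserve′ }
  where
    preserve′ : ∀ i k → Adj G i k → Adj (JetGraph G s) (i , zero) (k , zero)
    preserve′ i k _ with adj G i k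
    preserve′ i k refl | true = refl

theorem2 : (n : ℕ) (G : SimpleGraph (Fin n)) (c : ℕ) → .{{_ : NonZero c}} →
    HasChromaticNumber G c ⇔ (∀ (s : ℕ) → HasChromaticNumber (JetGraph G s) c)
theorem2 n G c = mk⇔
  (λ χG s → hasChromaticNumber-transport
     (jet-base-inclusion G s) (jet-projection G s) χG)
  (λ χJ → hasChromaticNumber-transport
     (jet-projection G 0) (jet-base-inclusion G 0) (χJ 0))
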